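{- Let $P(x,y)\in\mathbb{F}_p[x,y]$ be a polynomial of bidegree $(m,n)$ (i.e. $\deg_x P=m$, $\deg_y P=n$). Define polynomials $q_k(x,y),r_k(x,y)$, $k\in\mathbb{N}$, by $$q_1=-\frac{\partial P}{\partial x},\qquad r_1=\frac{\partial P}{\partial y},$$ $$q_{k+1}=\frac{\partial q_k}{\partial x}\left(\frac{\partial P}{\partial y}\right)^2-\frac{\partial q_k}{\partial y}\frac{\partial P}{\partial x}\frac{\partial P}{\partial y}-(2k-1)q_k\frac{\partial^2 P}{\partial x\partial y}\frac{\partial P}{\partial y}+(2k-1)q_k\frac{\partial^2 P}{\partial y^2}\frac{\partial P}{\partial x},$$ $$r_{k+1}=r_k\left(\frac{\partial P}{\partial y}\right)^2.$$ Then for all $k\in\mathbb{N}$, $$\deg_x q_k\leqslant(2k-1)m-k,\quad \deg_y q_k\leqslant(2k-1)n-k+1,$$ $$\deg_x r_k\leqslant(2k-1)m,\quad \deg_y r_k\leqslant(2k-1)(n-1).$$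
   Context: $\mathbb{N}=\{1,2,3,\dots\}$; partial derivatives are formal partial derivatives of polynomials over $\mathbb{F}_p$. -}

module Defs where

open import Data.Nat as ℕ using (ℕ; zero; suc; NonZero; _∸_)
open import Data.Nat.DivMod using (_mod_)
open import Data.Fin using (Fin; toℕ)
open import Data.Integer as ℤ using (ℤ; +_)
open import Data.Product using (∃₂; _×_)
open import Relation.Binary.PropositionalEquality using (_≡_; _≢_)

module Fp (p : ℕ) .{{_ : NonZero p}} where

  F : Set
  F = Fin p

  ι : ℕ → F
  ι n = n mod p

  0F : F
  0F = ι 0

  infixl 6 _+F_ _-F_
  infixl 7 _*F_

  _+F_ : F → F → F
  a +F b = ι (toℕ a ℕ.+ toℕ b)

  _*F_ : F → F → F
  a *F b = ι (toℕ a ℕ.* toℕ b)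

  -F_ : F → F
  -F a = ι (p ∸ toℕ a)

  _-F_ : F → F → F
  a -F b = a +F (-F b)

  ΣF : ℕ → (ℕ → F) → F
  ΣF zero f = f 0
  ΣF (suc i) f = ΣF i f +F f (suc i)

  -- Polynomials in F_p[x,y] given by coefficients: f i j is the coefficient of x^i y^j.
  -- (Only polynomials, i.e. finitely supported ones, arise in the statement:
  -- P has bounded bidegree and all other polynomials are built from it.)
  Poly : Set
  Poly = ℕ → ℕ → F

  infixl 6 _+P_ _-P_
  infixl 7 _*P_

  _+P_ : Poly → Poly → Poly
  (f +P g) i j = f i j +F g i j

  -P_ : Poly → Poly
  (-P f) i j = -F f i j

  _-P_ : Poly → Poly → Poly
  f -P g = f +P (-P g)

  _*P_ : Poly → Poly → Poly
  (f *P g) i j = ΣF i (λ a → ΣF j (λ b → f a b *F g (i ∸ a) (j ∸ b)))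

  _·P_ : ℕ → Poly → Poly
  (c ·P f) i j = ι c *F f i j

  ∂x : Poly → Poly
  ∂x f i j = ι (suc i) *F f (suc i) j

  ∂y : Poly → Poly
  ∂y f i j = ι (suc j) *F f i (suc j)

  -- deg_x f ≤ d  (d ∈ ℤ; the zero polynomial has degree -∞ and satisfies every bound)
  degX≤ : Poly → ℤ → Set
  degX≤ f d = ∀ i j → f i j ≢ 0F → + i ℤ.≤ d

  degY≤ : Poly → ℤ → Set
  degY≤ f d = ∀ i j → f i j ≢ 0F → + j ℤ.≤ d

  Bidegree : Poly → ℕ → ℕ → Set
  Bidegree f m n =
    degX≤ f (+ m) × degY≤ f (+ n)
    × (∃₂ λ i j → i ≡ m × f i j ≢ 0F)
    × (∃₂ λ i j → j ≡ n × f i j ≢ 0F)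

  module Seq (P : Poly) where
    Px Py Pxy Pyy : Poly
    Px = ∂x P
    Py = ∂y P
    Pxy = ∂y (∂x P)
    Pyy = ∂y (∂y P)

    -- q k and r k for k ≥ 1 (the value at k = 0 is an unused dummy, the zero polynomial)
    q : ℕ → Poly
    q zero = λ _ _ → 0F
    q (suc zero) = -P Px
    q (suc (suc k)) =
      let k' = suc k ; qk = q k' ; c = 2 ℕ.* k' ∸ 1 in
      ∂x qk *P (Py *P Py)
      -P ∂y qk *P Px *P Py
      -P c ·P (qk *P Pxy *P Py)
      +P c ·P (qk *P Pyy *P Px)

    r : ℕ → Poly
    r zero = λ _ _ → 0F
    r (suc zero) = Py
    r (suc (suc k)) = r (suc k) *P (Py *P Py)

module Submission where

-- A weight is a map w : ℕ × ℕ → ℕ with w(a+c, b+e) = w(a,b) + w(c,e); the weighted degree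
-- of f is the largest w(i,j) over the support of f.  Both deg_x (w(i,j) = i) and deg_y
-- (w(i,j) = j) are of this form.  For every such weight we establish the usual calculus:
-- weighted degree is subadditive under +, −, scalar multiples and products, and ∂x, ∂y
-- lower it by α = w(1,0) and β = w(0,1) respectively.  Feeding these rules through the
-- recursion for q_k, r_k (all four terms of q_{k+1} have the same bound) gives, if
-- deg_w P ≤ D,
--     deg_w q_k ≤ (2k−1)D − kα − 2(k−1)β,     deg_w r_k ≤ (2k−1)(D − β).
-- The theorem is the instance w = deg_x (α = 1, β = 0) together with the instance
-- w = deg_y (α = 0, β = 1); for deg_y q_k the sharp bound (2k−1)n − 2k + 2 is then
-- weakened to the stated (2k−1)n − k + 1.

open import Defs
open import Data.Nat using (ℕ; NonZero; _≤_)
open import Data.Nat.Primality using (Prime)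
open import Data.Integer using (+_; _+_; _-_; _*_)
open import Data.Product using (_×_)

open import Data.Nat as ℕ using (zero; suc)
import Data.Nat.Properties as ℕ
open import Data.Nat.DivMod using (_%_; m<n⇒m%n≡m; n%n≡0)
open import Data.Integer as ℤ using (ℤ)
import Data.Integer.Properties as ℤ
open import Data.Integer.Tactic.RingSolver using (solve-∀)
open import Data.Fin using (toℕ) renaming (_≟_ to _≟F_)
open import Data.Fin.Properties using (toℕ-injective; toℕ-fromℕ<)
open import Data.Product using (_,_; ∃)
open import Data.Sum using (_⊎_; inj₁; inj₂)
open import Relation.Nullary using (yes; no)
open import Relation.Binary.PropositionalEquality

-- Closed forms of the bounds: D bounds deg_w P, α = w(1,0), β = w(0,1), t = k.
qBound : ℤ → ℤ → ℤ → ℤ → ℤ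
qBound D α β t = (+ 2 * t - + 1) * D - t * α - + 2 * (t - + 1) * β

rBound : ℤ → ℤ → ℤ → ℤ
rBound D β t = (+ 2 * t - + 1) * (D - β)

q-base : ∀ D α β → D - α ≡ (+ 2 * + 1 - + 1) * D - + 1 * α - + 2 * (+ 1 - + 1) * β
q-base = solve-∀

r-base : ∀ D β → D - β ≡ (+ 2 * + 1 - + 1) * (D - β)
r-base = solve-∀

-- With Q = qBound D α β t, each term of q_{k+1} has degree at most Q + 2D − α − 2β.
q-term₁ : ∀ D α β t → ((+ 2 * t - + 1) * D - t * α - + 2 * (t - + 1) * β) - α + ((D - β) + (D - β))
  ≡ (+ 2 * (+ 1 + t) - + 1) * D - (+ 1 + t) * α - + 2 * ((+ 1 + t) - + 1) * β
q-term₁ = solve-∀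

q-term₂ : ∀ D α β t → ((+ 2 * t - + 1) * D - t * α - + 2 * (t - + 1) * β) - β + (D - α) + (D - β)
  ≡ (+ 2 * (+ 1 + t) - + 1) * D - (+ 1 + t) * α - + 2 * ((+ 1 + t) - + 1) * β
q-term₂ = solve-∀

q-term₃ : ∀ D α β t → ((+ 2 * t - + 1) * D - t * α - + 2 * (t - + 1) * β) + (D - α - β) + (D - β)
  ≡ (+ 2 * (+ 1 + t) - + 1) * D - (+ 1 + t) * α - + 2 * ((+ 1 + t) - + 1) * β
q-term₃ = solve-∀

q-term₄ : ∀ D α β t → ((+ 2 * t - + 1) * D - t * α - + 2 * (t - + 1) * β) + (D - β - β) + (D - α)
  ≡ (+ 2 * (+ 1 + t) - + 1) * D - (+ 1 + t) * α - + 2 * ((+ 1 + t) - + 1) * β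
q-term₄ = solve-∀

r-term : ∀ D β t → (+ 2 * t - + 1) * (D - β) + ((D - β) + (D - β))
  ≡ (+ 2 * (+ 1 + t) - + 1) * (D - β)
r-term = solve-∀

q-degX : ∀ M t → (+ 2 * t - + 1) * M - t * + 1 - + 2 * (t - + 1) * + 0 ≡ (+ 2 * t - + 1) * M - t
q-degX = solve-∀

r-degX : ∀ M t → (+ 2 * t - + 1) * (M - + 0) ≡ (+ 2 * t - + 1) * M
r-degX = solve-∀

-- For t = 1 + k the sharp deg_y bound of q falls short of the stated one by exactly k.
q-degY : ∀ N k → (+ 2 * (+ 1 + k) - + 1) * N - (+ 1 + k) * + 0 - + 2 * ((+ 1 + k) - + 1) * + 1
  ≡ (+ 2 * (+ 1 + k) - + 1) * N - (+ 1 + k) + + 1 - k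
q-degY = solve-∀

shift-bound : ∀ a b (d : ℤ) → + (a ℕ.+ b) ℤ.≤ d → + b ℤ.≤ d - + a
shift-bound a b d h = subst (ℤ._≤ d - + a) (cancel-left (+ a) (+ b))
  (ℤ.+-monoˡ-≤ (ℤ.- + a) (subst (ℤ._≤ d) (ℤ.pos-+ a b) h))
  where
    cancel-left : ∀ x y → x + y - x ≡ y
    cancel-left = solve-∀

module Field (p : ℕ) .{{_ : NonZero p}} where
  open Fp p

  toℕ-0F : toℕ 0F ≡ 0
  toℕ-0F = trans (toℕ-fromℕ< _) (m<n⇒m%n≡m (ℕ.>-nonZero⁻¹ p))

  zero-*F : ∀ a → 0F *F a ≡ 0F
  zero-*F a = cong ι (cong (ℕ._* toℕ a) toℕ-0F)

  *F-zero : ∀ a → a *F 0F ≡ 0F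
  *F-zero a = cong ι (trans (cong (toℕ a ℕ.*_) toℕ-0F) (ℕ.*-zeroʳ (toℕ a)))

  zero-+F-zero : 0F +F 0F ≡ 0F
  zero-+F-zero = cong ι (cong₂ ℕ._+_ toℕ-0F toℕ-0F)

  -F-zero : -F 0F ≡ 0F
  -F-zero = toℕ-injective (begin
    toℕ (-F 0F)           ≡⟨ toℕ-fromℕ< _ ⟩
    (p ℕ.∸ toℕ 0F) % p    ≡⟨ cong (λ z → (p ℕ.∸ z) % p) toℕ-0F ⟩
    p % p                 ≡⟨ n%n≡0 p ⟩
    0                     ≡⟨ sym toℕ-0F ⟩
    toℕ 0F                ∎)
    where open ≡-Reasoning

  nonzero-argument : ∀ (φ : F → F) → φ 0F ≡ 0F → ∀ x → φ x ≢ 0F → x ≢ 0F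
  nonzero-argument φ φ0 x φx≢0 x≡0 = φx≢0 (trans (cong φ x≡0) φ0)

  nonzero-+F : ∀ x y → x +F y ≢ 0F → x ≢ 0F ⊎ y ≢ 0F
  nonzero-+F x y ne with x ≟F 0F
  ... | no x≢0 = inj₁ x≢0
  ... | yes x≡0 = inj₂ (λ y≡0 → ne (trans (cong₂ _+F_ x≡0 y≡0) zero-+F-zero))

  nonzero-*F : ∀ x y → x *F y ≢ 0F → x ≢ 0F × y ≢ 0F
  nonzero-*F x y ne = nonzero-argument (_*F y) (zero-*F y) x ne
                    , nonzero-argument (x *F_) (*F-zero x) y ne

  nonzero-ΣF : ∀ i (h : ℕ → F) → ΣF i h ≢ 0F → ∃ λ a → a ≤ i × h a ≢ 0F
  nonzero-ΣF zero h ne = 0 , ℕ.z≤n , ne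
  nonzero-ΣF (suc i) h ne with nonzero-+F (ΣF i h) (h (suc i)) ne
  ... | inj₂ last≢0 = suc i , ℕ.≤-refl , last≢0
  ... | inj₁ rest≢0 with nonzero-ΣF i h rest≢0
  ...   | a , a≤i , ha≢0 = a , ℕ.m≤n⇒m≤1+n a≤i , ha≢0

Additive : (ℕ → ℕ → ℕ) → Set
Additive w = ∀ a b c e → w (a ℕ.+ c) (b ℕ.+ e) ≡ w a b ℕ.+ w c e

module WeightedDegree (p : ℕ) .{{_ : NonZero p}} (w : ℕ → ℕ → ℕ) (additive : Additive w) where
  open Fp p
  open Field p

  -- deg_w f ≤ d; for w = (λ i j → i) this is definitionally degX≤, for (λ i j → j) degY≤.
  deg≤ : Poly → ℤ → Set
  deg≤ f d = ∀ i j → f i j ≢ 0F → + w i j ℤ.≤ d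

  α β : ℤ
  α = + w 1 0
  β = + w 0 1

  deg-mono : ∀ {f d d′} → deg≤ f d → d ℤ.≤ d′ → deg≤ f d′
  deg-mono hf d≤d′ i j ne = ℤ.≤-trans (hf i j ne) d≤d′

  deg-cast : ∀ {f d d′} → deg≤ f d → d ≡ d′ → deg≤ f d′
  deg-cast hf refl = hf

  deg-+ : ∀ {f g d} → deg≤ f d → deg≤ g d → deg≤ (f +P g) d
  deg-+ {f} {g} hf hg i j ne with nonzero-+F (f i j) (g i j) ne
  ... | inj₁ f≢0 = hf i j f≢0
  ... | inj₂ g≢0 = hg i j g≢0

  deg-neg : ∀ {f d} → deg≤ f d → deg≤ (-P f) d
  deg-neg {f} hf i j ne = hf i j (nonzero-argument -F_ -F-zero (f i j) ne)

  deg-scale : ∀ {f d} c → deg≤ f d → deg≤ (c ·P f) d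
  deg-scale {f} c hf i j ne = hf i j (nonzero-argument (ι c *F_) (*F-zero (ι c)) (f i j) ne)

  -- deg_w (fg) ≤ deg_w f + deg_w g: a nonzero coefficient of fg comes from a product of
  -- nonzero coefficients of f and g at exponents summing to (i, j).
  deg-* : ∀ {f g u v} → deg≤ f u → deg≤ g v → deg≤ (f *P g) (u + v)
  deg-* {f} {g} {u} {v} hf hg i j ne
    with nonzero-ΣF i _ ne
  ... | a , a≤i , row≢0 with nonzero-ΣF j _ row≢0
  ...   | b , b≤j , term≢0 with nonzero-*F (f a b) (g (i ℕ.∸ a) (j ℕ.∸ b)) term≢0
  ...     | f≢0 , g≢0 =
    subst (ℤ._≤ u + v) weight-splits (ℤ.+-mono-≤ (hf a b f≢0) (hg (i ℕ.∸ a) (j ℕ.∸ b) g≢0))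
    where
      weight-splits : + w a b + + w (i ℕ.∸ a) (j ℕ.∸ b) ≡ + w i j
      weight-splits = begin
        + w a b + + w (i ℕ.∸ a) (j ℕ.∸ b)     ≡⟨ sym (ℤ.pos-+ (w a b) _) ⟩
        + (w a b ℕ.+ w (i ℕ.∸ a) (j ℕ.∸ b))   ≡⟨ cong +_ (sym (additive a b _ _)) ⟩
        + w (a ℕ.+ (i ℕ.∸ a)) (b ℕ.+ (j ℕ.∸ b)) ≡⟨ cong₂ (λ x y → + w x y) (ℕ.m+[n∸m]≡n a≤i) (ℕ.m+[n∸m]≡n b≤j) ⟩
        + w i j                                ∎
        where open ≡-Reasoning

  deg-∂x : ∀ {f d} → deg≤ f d → deg≤ (∂x f) (d - α)
  deg-∂x {f} {d} hf i j ne =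
    shift-bound (w 1 0) (w i j) d
      (subst (λ z → + z ℤ.≤ d) (additive 1 0 i j)
        (hf (suc i) j (nonzero-argument (ι (suc i) *F_) (*F-zero (ι (suc i))) (f (suc i) j) ne)))

  deg-∂y : ∀ {f d} → deg≤ f d → deg≤ (∂y f) (d - β)
  deg-∂y {f} {d} hf i j ne =
    shift-bound (w 0 1) (w i j) d
      (subst (λ z → + z ℤ.≤ d) (additive 0 1 i j)
        (hf i (suc j) (nonzero-argument (ι (suc j) *F_) (*F-zero (ι (suc j))) (f i (suc j)) ne)))

  module Recursion (P : Poly) (D : ℤ) (deg-P : deg≤ P D) where
    open Seq P

    deg-Px : deg≤ Px (D - α)
    deg-Px = deg-∂x deg-P

    deg-Py : deg≤ Py (D - β)
    deg-Py = deg-∂y deg-P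

    deg-Pxy : deg≤ Pxy (D - α - β)
    deg-Pxy = deg-∂y deg-Px

    deg-Pyy : deg≤ Pyy (D - β - β)
    deg-Pyy = deg-∂y deg-Py

    bounds : ∀ k′ → deg≤ (q (suc k′)) (qBound D α β (+ suc k′))
                  × deg≤ (r (suc k′)) (rBound D β (+ suc k′))
    bounds zero = deg-cast (deg-neg deg-Px) (q-base D α β) , deg-cast deg-Py (r-base D β)
    bounds (suc k′) with bounds k′
    ... | deg-q , deg-r =
      deg-+ (deg-+ (deg-+ term₁ (deg-neg term₂)) (deg-neg (deg-scale c term₃))) (deg-scale c term₄)
      , deg-cast (deg-* deg-r (deg-* deg-Py deg-Py)) (r-term D β t)
      where
        t = + suc k′
        c = 2 ℕ.* suc k′ ℕ.∸ 1
        qk = q (suc k′)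
        term₁ : deg≤ (∂x qk *P (Py *P Py)) (qBound D α β (+ 1 + t))
        term₁ = deg-cast (deg-* (deg-∂x deg-q) (deg-* deg-Py deg-Py)) (q-term₁ D α β t)
        term₂ : deg≤ (∂y qk *P Px *P Py) (qBound D α β (+ 1 + t))
        term₂ = deg-cast (deg-* (deg-* (deg-∂y deg-q) deg-Px) deg-Py) (q-term₂ D α β t)
        term₃ : deg≤ (qk *P Pxy *P Py) (qBound D α β (+ 1 + t))
        term₃ = deg-cast (deg-* (deg-* deg-q deg-Pxy) deg-Py) (q-term₃ D α β t)
        term₄ : deg≤ (qk *P Pyy *P Px) (qBound D α β (+ 1 + t))
        term₄ = deg-cast (deg-* (deg-* deg-q deg-Pyy) deg-Px) (q-term₄ D α β t)

lemma4 : (p : ℕ) .{{_ : NonZero p}} → Prime p →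
    (P : Fp.Poly p) (m n : ℕ) → Fp.Bidegree p P m n →
    (k : ℕ) → 1 ≤ k →
    Fp.degX≤ p (Fp.Seq.q p P k) ((+ 2 * + k - + 1) * + m - + k)
    × Fp.degY≤ p (Fp.Seq.q p P k) ((+ 2 * + k - + 1) * + n - + k + + 1)
    × Fp.degX≤ p (Fp.Seq.r p P k) ((+ 2 * + k - + 1) * + m)
    × Fp.degY≤ p (Fp.Seq.r p P k) ((+ 2 * + k - + 1) * (+ n - + 1))
lemma4 p _ P m n (degX-P , degY-P , _) (suc k) _ =
  let degX-q , degX-r = X.Recursion.bounds P (+ m) degX-P k
      degY-q , degY-r = Y.Recursion.bounds P (+ n) degY-P k
  in X.deg-cast degX-q (q-degX (+ m) (+ suc k))
   , Y.deg-mono degY-q (ℤ.≤-trans (ℤ.≤-reflexive (q-degY (+ n) (+ k))) (ℤ.i-j≤i _ (+ k)))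
   , X.deg-cast degX-r (r-degX (+ m) (+ suc k))
   , degY-r
  where
    module X = WeightedDegree p (λ i _ → i) (λ _ _ _ _ → refl)
    module Y = WeightedDegree p (λ _ j → j) (λ _ _ _ _ → refl)
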